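{- Let $P\subset\mathbb{R}^2$ be a lattice polygon and let $l={\rm e}_\square(P)$. Suppose that $\Delta_P(x+y)\geq l$ and $\Delta_P(x-y)\geq l$. Then $\Delta_P(ax+by)\geq l$ for every primitive direction $(a,b)\in\mathbb{Z}^2$, except possibly for $(a,b)\in\{(\pm1,0),(0,\pm1)\}$. Consequently ${\rm ls}_\square(P)=l$ and $\operatorname{w}(P)=\min\{\Delta_P(x),\Delta_P(y)\}$.
   Context: A lattice polygon is the convex hull of finitely many points of $\mathbb{Z}^2$. For a linear function $f(x,y)=ax+by$ with $a,b\in\mathbb{Z}$, $\Delta_P(f)=\max_{p\in P}f(p)-\min_{p\in P}f(p)$; for a primitive vector $(a,b)$ (i.e. $\gcd(a,b)=1$) this is the lattice width $\operatorname{w}_{(a,b)}(P)$ of $P$ in direction $(a,b)$, and the lattice width $\operatorname{w}(P)$ is the minimum of $\operatorname{w}_{(a,b)}(P)$ over all primitive directions. ${\rm e}_\square(P)$ is the smallest integer $l$ such that some lattice translate of $P$ is contained in $l\square=[0,l]^2$; equivalently ${\rm e}_\square(P)=\max\{\Delta_P(x),\Delta_P(y)\}$. An affine unimodular transformation is a map $T(p)=Ap+v$ with $A$ an integer matrix with $\det A=\pm1$ and $v\in\mathbb{Z}^2$. The lattice size ${\rm ls}_\square(P)$ is the smallest integer $l$ such that $T(P)\subseteq[0,l]^2$ for some affine unimodular transformation $T$. -}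

module Defs where

open import Data.Integer using (ℤ; +_; -_; _+_; _-_; _*_; _≤_; _⊔_; _⊓_; ∣_∣)
open import Data.Integer.GCD using (gcd)
open import Data.List.NonEmpty using (List⁺; _∷_; foldr₁; map)
open import Data.List.Relation.Unary.All using (All)
open import Data.Nat using (ℕ)
open import Data.Product using (_×_; _,_; Σ; ∃; proj₁; proj₂)
open import Data.Sum using (_⊎_)
open import Relation.Binary.PropositionalEquality using (_≡_)

Point : Set
Point = ℤ × ℤ

-- A lattice polygon P is given by a nonempty finite list of lattice points;
-- P is (by definition) the convex hull conv(S) of these points S.
LatticePolygon : Set
LatticePolygon = List⁺ Point

lin : ℤ → ℤ → Point → ℤ
lin a b (x , y) = a * x + b * y

-- max / min of f over P = conv(S); for a linear f these are attained on S.
maxP : LatticePolygon → ℤ → ℤ → ℤ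
maxP S a b = foldr₁ _⊔_ (map (lin a b) S)

minP : LatticePolygon → ℤ → ℤ → ℤ
minP S a b = foldr₁ _⊓_ (map (lin a b) S)

Δ : LatticePolygon → ℤ → ℤ → ℤ
Δ P a b = maxP P a b - minP P a b

Primitive : ℤ → ℤ → Set
Primitive a b = gcd a b ≡ + 1

AxisDir : ℤ → ℤ → Set
AxisDir a b = (∣ a ∣ ≡ 1 × b ≡ + 0) ⊎ (a ≡ + 0 × ∣ b ∣ ≡ 1)

e□ : LatticePolygon → ℤ
e□ P = Δ P (+ 1) (+ 0) ⊔ Δ P (+ 0) (+ 1)

record AffUnimodular : Set where
  constructor affUni
  field
    m11 m12 m21 m22 v1 v2 : ℤ
    det±1 : (m11 * m22 - m12 * m21 ≡ + 1) ⊎ (m11 * m22 - m12 * m21 ≡ - (+ 1))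

applyT : AffUnimodular → Point → Point
applyT T (x , y) = (m11 * x + m12 * y + v1 , m21 * x + m22 * y + v2)
  where open AffUnimodular T

InBox : ℤ → Point → Set
InBox l (x , y) = (+ 0 ≤ x × x ≤ l) × (+ 0 ≤ y × y ≤ l)

-- T(P) ⊆ [0,l]²; since [0,l]² is convex and T is affine, this holds iff
-- T maps every generating point of P = conv(S) into [0,l]².
MapsIntoBox : AffUnimodular → LatticePolygon → ℤ → Set
MapsIntoBox T P l = All (λ p → InBox l (applyT T p)) (Data.List.NonEmpty.toList P)

IsLatticeSize : LatticePolygon → ℤ → Set
IsLatticeSize P l =
  (Σ AffUnimodular λ T → MapsIntoBox T P l) ×
  (∀ (l' : ℤ) (T : AffUnimodular) → MapsIntoBox T P l' → l ≤ l')

IsLatticeWidth : LatticePolygon → ℤ → Set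
IsLatticeWidth P w =
  (Σ ℤ λ a → Σ ℤ λ b → Primitive a b × Δ P a b ≡ w) ×
  (∀ (a b : ℤ) → Primitive a b → w ≤ Δ P a b)

-- Since P = conv(S), the spread
-- Δ_P(ax+by) is the largest value of a·u + b·v over the offsets (u,v) = p - q
-- of points p, q ∈ S, and this maximum is attained.  Every such offset has
-- u ≤ l and v ≤ l.  If (u,v) is an offset attaining Δ_P(x+y) ≥ l, then
-- l ≤ u + v together with u, v ≤ l forces u, v ≥ 0, hence
-- A·u + B·v ≥ u + v ≥ l for all A, B ≥ 1; so Δ_P(Ax+By) ≥ l.  The offset
-- attaining Δ_P(x-y) does the same for the directions (A,-B), and the
-- symmetry Δ_P(-f) = Δ_P(f) covers the remaining sign patterns.  For axis
-- directions, scaling gives Δ_P(ax) ≥ Δ_P(x) and Δ_P(by) ≥ Δ_P(y).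

module Submission where

open import Defs
open import Data.Integer using (ℤ; +_; -_; _≤_; _⊓_)
open import Data.Product using (_×_)
open import Relation.Nullary using (¬_)

open import Algebra.Definitions using (Selective)
open import Data.Empty using (⊥-elim)
open import Data.Integer using (_+_; _-_; _*_; _⊔_; +≤+; 0ℤ; ∣_∣; +[1+_]; -[1+_])
open import Data.Integer.Properties
open import Data.Integer.Tactic.RingSolver using (solve-∀)
import Data.Nat as ℕ
import Data.Nat.GCD as ℕ
import Data.Nat.Properties as ℕ
open import Data.List using ([]; _∷_)
open import Data.List.Membership.Propositional using (_∈_)
open import Data.List.NonEmpty using (_∷_; head; foldr₁; map; toList)
open import Data.List.Relation.Unary.All using (tabulate; lookup)
open import Data.List.Relation.Unary.Any using (here; there)
open import Data.Product using (_,_; Σ; ∃-syntax; proj₁; proj₂)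
open import Data.Sum using (_⊎_; inj₁; inj₂)
open import Relation.Nullary using (yes; no)
open import Relation.Binary.PropositionalEquality

≤-foldr₁-max : (f : Point → ℤ) (S : LatticePolygon) {p : Point} →
               p ∈ toList S → f p ≤ foldr₁ _⊔_ (map f S)
≤-foldr₁-max f (x ∷ []) (here refl) = ≤-refl
≤-foldr₁-max f (x ∷ y ∷ ys) (here refl) = i≤i⊔j _ _
≤-foldr₁-max f (x ∷ y ∷ ys) (there p∈) =
  ≤-trans (≤-foldr₁-max f (y ∷ ys) p∈) (i≤j⊔i _ _)

foldr₁-min-≤ : (f : Point → ℤ) (S : LatticePolygon) {p : Point} →
               p ∈ toList S → foldr₁ _⊓_ (map f S) ≤ f p
foldr₁-min-≤ f (x ∷ []) (here refl) = ≤-refl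
foldr₁-min-≤ f (x ∷ y ∷ ys) (here refl) = i⊓j≤i _ _
foldr₁-min-≤ f (x ∷ y ∷ ys) (there p∈) =
  ≤-trans (i⊓j≤j _ _) (foldr₁-min-≤ f (y ∷ ys) p∈)

foldr₁-attained : (_∙_ : ℤ → ℤ → ℤ) → Selective _≡_ _∙_ →
                  (f : Point → ℤ) (S : LatticePolygon) →
                  ∃[ p ] p ∈ toList S × foldr₁ _∙_ (map f S) ≡ f p
foldr₁-attained _∙_ sel f (x ∷ xs) = attained x xs
  where
  attained : ∀ x xs → ∃[ p ] p ∈ toList (x ∷ xs) × foldr₁ _∙_ (map f (x ∷ xs)) ≡ f p
  attained x [] = x , here refl , refl
  attained x (y ∷ ys) with sel (f x) (foldr₁ _∙_ (map f (y ∷ ys))) | attained y ys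
  ... | inj₁ picks-x | _ = x , here refl , picks-x
  ... | inj₂ picks-rest | p , p∈ , rest≡fp = p , there p∈ , trans picks-rest rest≡fp

≤-*-pos : ∀ m {d} → 0ℤ ≤ d → d ≤ +[1+ m ] * d
≤-*-pos m {+ n} _ = subst (+ n ≤_) (pos-* (ℕ.suc m) n) (+≤+ (ℕ.m≤n*m n (ℕ.suc m)))

nonneg-from-sum : ∀ {u v l} → v ≤ l → l ≤ u + v → 0ℤ ≤ u
nonneg-from-sum {u} {v} v≤l l≤u+v =
  subst (0ℤ ≤_) (cancel u v) (i≤j⇒0≤j-i (≤-trans v≤l l≤u+v))
  where
  cancel : ∀ u v → u + v - v ≡ u
  cancel = solve-∀

-- The core inequality: if u, v ≤ l ≤ u + v, then l ≤ A·u + B·v for all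
-- A, B ≥ 1 (the hypotheses force u, v ≥ 0).
diagonal-dominance : ∀ m n {u v l} → u ≤ l → v ≤ l → l ≤ u + v →
                     l ≤ +[1+ m ] * u + +[1+ n ] * v
diagonal-dominance m n {u} {v} u≤l v≤l l≤u+v = ≤-trans l≤u+v
  (+-mono-≤ (≤-*-pos m (nonneg-from-sum {u} {v} v≤l l≤u+v))
            (≤-*-pos n (nonneg-from-sum {v} {u} u≤l (subst (_ ≤_) (+-comm u v) l≤u+v))))

_⊖_ : Point → Point → Point
(x₁ , y₁) ⊖ (x₂ , y₂) = (x₁ - x₂ , y₁ - y₂)

lin-⊖ : ∀ a b p q → lin a b p - lin a b q ≡ lin a b (p ⊖ q)
lin-⊖ a b (x₁ , y₁) (x₂ , y₂) = identity a b x₁ y₁ x₂ y₂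
  where
  identity : ∀ a b x₁ y₁ x₂ y₂ →
             (a * x₁ + b * y₁) - (a * x₂ + b * y₂) ≡ a * (x₁ - x₂) + b * (y₁ - y₂)
  identity = solve-∀

lin-x : ∀ o → lin (+ 1) (+ 0) o ≡ proj₁ o
lin-x (u , v) = identity u v
  where
  identity : ∀ u v → + 1 * u + + 0 * v ≡ u
  identity = solve-∀

lin-y : ∀ o → lin (+ 0) (+ 1) o ≡ proj₂ o
lin-y (u , v) = identity u v
  where
  identity : ∀ u v → + 0 * u + + 1 * v ≡ v
  identity = solve-∀

module _ (P : LatticePolygon) where

  Δ-upper : ∀ a b {p q} → p ∈ toList P → q ∈ toList P → lin a b (p ⊖ q) ≤ Δ P a b
  Δ-upper a b {p} {q} p∈ q∈ = subst (_≤ Δ P a b) (lin-⊖ a b p q)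
    (+-mono-≤ (≤-foldr₁-max (lin a b) P p∈) (neg-mono-≤ (foldr₁-min-≤ (lin a b) P q∈)))

  record Attaining (a b : ℤ) : Set where
    constructor attaining
    field
      {top bottom} : Point
      top∈         : top ∈ toList P
      bottom∈      : bottom ∈ toList P
      Δ≡           : Δ P a b ≡ lin a b (top ⊖ bottom)

  Δ-attained : ∀ a b → Attaining a b
  Δ-attained a b
    with foldr₁-attained _⊔_ ⊔-sel (lin a b) P | foldr₁-attained _⊓_ ⊓-sel (lin a b) P
  ... | p , p∈ , max≡ | q , q∈ , min≡ =
    attaining p∈ q∈ (trans (cong₂ _-_ max≡ min≡) (lin-⊖ a b p q))

  Δ-nonneg : ∀ a b → 0ℤ ≤ Δ P a b
  Δ-nonneg a b =
    i≤j⇒0≤j-i (≤-trans (foldr₁-min-≤ (lin a b) P p∈) (≤-foldr₁-max (lin a b) P p∈))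
    where
    p∈ : head P ∈ toList P
    p∈ = here refl

  -- Δ_P(-f) ≤ Δ_P(f): the offset attaining Δ_P(-f), reversed, is an offset for f.
  Δ-neg-≤ : ∀ a b → Δ P (- a) (- b) ≤ Δ P a b
  Δ-neg-≤ a b with Δ-attained (- a) (- b)
  ... | attaining {p} {q} p∈ q∈ Δ≡ =
    subst (_≤ Δ P a b) (sym (trans Δ≡ (reverse a b p q))) (Δ-upper a b q∈ p∈)
    where
    reverse : ∀ a b p q → lin (- a) (- b) (p ⊖ q) ≡ lin a b (q ⊖ p)
    reverse a b (x₁ , y₁) (x₂ , y₂) = identity a b x₁ y₁ x₂ y₂
      where
      identity : ∀ a b x₁ y₁ x₂ y₂ →
                 (- a) * (x₁ - x₂) + (- b) * (y₁ - y₂) ≡ a * (x₂ - x₁) + b * (y₂ - y₁)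
      identity = solve-∀

  Δ-neg : ∀ a b → Δ P (- a) (- b) ≡ Δ P a b
  Δ-neg a b = ≤-antisym (Δ-neg-≤ a b)
    (subst₂ (λ a′ b′ → Δ P a′ b′ ≤ Δ P (- a) (- b))
            (neg-involutive a) (neg-involutive b) (Δ-neg-≤ (- a) (- b)))

  Δ-scale-pos : ∀ m a b → Δ P a b ≤ Δ P (+[1+ m ] * a) (+[1+ m ] * b)
  Δ-scale-pos m a b with Δ-attained a b
  ... | attaining {p} {q} p∈ q∈ Δ≡ = subst (_≤ _) (sym Δ≡)
    (≤-trans (≤-*-pos m (subst (0ℤ ≤_) Δ≡ (Δ-nonneg a b)))
             (subst (_≤ _) (scale +[1+ m ] a b (p ⊖ q))
                    (Δ-upper (+[1+ m ] * a) (+[1+ m ] * b) p∈ q∈)))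
    where
    scale : ∀ k a b o → lin (k * a) (k * b) o ≡ k * lin a b o
    scale k a b (u , v) = identity k a b u v
      where
      identity : ∀ k a b u v → (k * a) * u + (k * b) * v ≡ k * (a * u + b * v)
      identity = solve-∀

  Δ-scale : ∀ k a b → ¬ k ≡ 0ℤ → Δ P a b ≤ Δ P (k * a) (k * b)
  Δ-scale (+ 0) a b k≢0 = ⊥-elim (k≢0 refl)
  Δ-scale +[1+ m ] a b _ = Δ-scale-pos m a b
  Δ-scale -[1+ m ] a b _ = subst (Δ P a b ≤_) spread≡ (Δ-scale-pos m a b)
    where
    spread≡ : Δ P (+[1+ m ] * a) (+[1+ m ] * b) ≡ Δ P (-[1+ m ] * a) (-[1+ m ] * b)
    spread≡ = trans (sym (Δ-neg (+[1+ m ] * a) (+[1+ m ] * b)))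
      (cong₂ (Δ P) (neg-distribˡ-* +[1+ m ] a) (neg-distribˡ-* +[1+ m ] b))

  Δ-within : ∀ a b v h →
             (∀ {p} → p ∈ toList P → (0ℤ ≤ lin a b p + v) × (lin a b p + v ≤ h)) →
             Δ P a b ≤ h
  Δ-within a b v h in-range with Δ-attained a b
  ... | attaining {p} {q} p∈ q∈ Δ≡ = subst (_≤ h) (sym (trans Δ≡ (shift p q)))
      (subst (_ ≤_) (+-identityʳ h)
        (+-mono-≤ (proj₂ (in-range p∈)) (neg-mono-≤ (proj₁ (in-range q∈)))))
    where
    shift : ∀ p q → lin a b (p ⊖ q) ≡ (lin a b p + v) - (lin a b q + v)
    shift p q = trans (sym (lin-⊖ a b p q)) (identity (lin a b p) (lin a b q) v)
      where
      identity : ∀ s t v → s - t ≡ (s + v) - (t + v)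
      identity = solve-∀

  shifted-range : ∀ a b {p} → p ∈ toList P →
                  (0ℤ ≤ lin a b p - minP P a b) × (lin a b p - minP P a b ≤ Δ P a b)
  shifted-range a b p∈ = i≤j⇒0≤j-i (foldr₁-min-≤ (lin a b) P p∈)
                       , +-monoˡ-≤ (- minP P a b) (≤-foldr₁-max (lin a b) P p∈)

module _ (P : LatticePolygon) where

  private
    l Δx Δy : ℤ
    l  = e□ P
    Δx = Δ P (+ 1) (+ 0)
    Δy = Δ P (+ 0) (+ 1)

  offset-x≤l : ∀ {p q} → p ∈ toList P → q ∈ toList P → proj₁ (p ⊖ q) ≤ l
  offset-x≤l {p} {q} p∈ q∈ =
    ≤-trans (subst (_≤ Δx) (lin-x (p ⊖ q)) (Δ-upper P (+ 1) (+ 0) p∈ q∈)) (i≤i⊔j Δx Δy)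

  offset-y≤l : ∀ {p q} → p ∈ toList P → q ∈ toList P → proj₂ (p ⊖ q) ≤ l
  offset-y≤l {p} {q} p∈ q∈ =
    ≤-trans (subst (_≤ Δy) (lin-y (p ⊖ q)) (Δ-upper P (+ 0) (+ 1) p∈ q∈)) (i≤j⊔i Δx Δy)

  bound-same-signs : l ≤ Δ P (+ 1) (+ 1) → ∀ m n → l ≤ Δ P +[1+ m ] +[1+ n ]
  bound-same-signs l≤Δ₊ m n with Δ-attained P (+ 1) (+ 1)
  ... | attaining {p} {q} p∈ q∈ Δ≡ = ≤-trans
    (diagonal-dominance m n (offset-x≤l p∈ q∈) (offset-y≤l p∈ q∈)
      (subst (l ≤_) (trans Δ≡ (sum (p ⊖ q))) l≤Δ₊))
    (Δ-upper P +[1+ m ] +[1+ n ] p∈ q∈)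
    where
    sum : ∀ o → lin (+ 1) (+ 1) o ≡ proj₁ o + proj₂ o
    sum (u , v) = identity u v
      where
      identity : ∀ u v → + 1 * u + + 1 * v ≡ u + v
      identity = solve-∀

  -- Directions (A,-B) with A, B ≥ 1, via the offset attaining Δ_P(x-y):
  -- its x-coordinate and its negated y-coordinate play the roles of u, v.
  bound-opposite-signs : l ≤ Δ P (+ 1) (- (+ 1)) → ∀ m n → l ≤ Δ P +[1+ m ] -[1+ n ]
  bound-opposite-signs l≤Δ₋ m n with Δ-attained P (+ 1) (- (+ 1))
  ... | attaining {p} {q} p∈ q∈ Δ≡ = ≤-trans
    (diagonal-dominance m n (offset-x≤l p∈ q∈) (offset-y≤l q∈ p∈)
      (subst (l ≤_) (trans Δ≡ (difference p q)) l≤Δ₋))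
    (subst (_≤ _) (reflect m n p q) (Δ-upper P +[1+ m ] -[1+ n ] p∈ q∈))
    where
    difference : ∀ p q → lin (+ 1) (- (+ 1)) (p ⊖ q) ≡ proj₁ (p ⊖ q) + proj₂ (q ⊖ p)
    difference (x₁ , y₁) (x₂ , y₂) = identity x₁ y₁ x₂ y₂
      where
      identity : ∀ x₁ y₁ x₂ y₂ →
                 + 1 * (x₁ - x₂) + (- + 1) * (y₁ - y₂) ≡ (x₁ - x₂) + (y₂ - y₁)
      identity = solve-∀
    reflect : ∀ m n p q → lin +[1+ m ] -[1+ n ] (p ⊖ q) ≡
              +[1+ m ] * proj₁ (p ⊖ q) + +[1+ n ] * proj₂ (q ⊖ p)
    reflect m n (x₁ , y₁) (x₂ , y₂) = identity +[1+ m ] +[1+ n ] x₁ y₁ x₂ y₂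
      where
      identity : ∀ A B x₁ y₁ x₂ y₂ →
                 A * (x₁ - x₂) + (- B) * (y₁ - y₂) ≡ A * (x₁ - x₂) + B * (y₂ - y₁)
      identity = solve-∀

  off-axis-bound : l ≤ Δ P (+ 1) (+ 1) → l ≤ Δ P (+ 1) (- (+ 1)) →
                   ∀ a b → ¬ a ≡ 0ℤ → ¬ b ≡ 0ℤ → l ≤ Δ P a b
  off-axis-bound _ _ (+ 0) _ a≢0 _ = ⊥-elim (a≢0 refl)
  off-axis-bound _ _ _ (+ 0) _ b≢0 = ⊥-elim (b≢0 refl)
  off-axis-bound l≤Δ₊ _ +[1+ m ] +[1+ n ] _ _ = bound-same-signs l≤Δ₊ m n
  off-axis-bound _ l≤Δ₋ +[1+ m ] -[1+ n ] _ _ = bound-opposite-signs l≤Δ₋ m n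
  off-axis-bound l≤Δ₊ _ -[1+ m ] -[1+ n ] _ _ =
    subst (l ≤_) (sym (Δ-neg P +[1+ m ] +[1+ n ])) (bound-same-signs l≤Δ₊ m n)
  off-axis-bound _ l≤Δ₋ -[1+ m ] +[1+ n ] _ _ =
    subst (l ≤_) (sym (Δ-neg P +[1+ m ] -[1+ n ])) (bound-opposite-signs l≤Δ₋ m n)

  x-axis-bound : ∀ a → ¬ a ≡ 0ℤ → Δx ≤ Δ P a (+ 0)
  x-axis-bound a a≢0 = subst (Δx ≤_) (cong₂ (Δ P) (*-identityʳ a) (*-zeroʳ a))
    (Δ-scale P a (+ 1) (+ 0) a≢0)

  y-axis-bound : ∀ b → ¬ b ≡ 0ℤ → Δy ≤ Δ P (+ 0) b
  y-axis-bound b b≢0 = subst (Δy ≤_) (cong₂ (Δ P) (*-zeroʳ b) (*-identityʳ b))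
    (Δ-scale P b (+ 0) (+ 1) b≢0)

  -- First claim: the bound holds for every primitive non-axis direction.
  -- A primitive direction with a zero coordinate is an axis direction.
  primitive-bound : l ≤ Δ P (+ 1) (+ 1) → l ≤ Δ P (+ 1) (- (+ 1)) →
                    ∀ a b → Primitive a b → ¬ AxisDir a b → l ≤ Δ P a b
  primitive-bound l≤Δ₊ l≤Δ₋ a b prim not-axis with a ≟ 0ℤ | b ≟ 0ℤ
  ... | yes refl | _ =
    ⊥-elim (not-axis (inj₂ (refl , trans (sym (ℕ.gcd-identityˡ ∣ b ∣)) (+-injective prim))))
  ... | no _ | yes refl =
    ⊥-elim (not-axis (inj₁ (trans (sym (ℕ.gcd-identityʳ ∣ a ∣)) (+-injective prim) , refl)))
  ... | no a≢0 | no b≢0 = off-axis-bound l≤Δ₊ l≤Δ₋ a b a≢0 b≢0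

  private
    det≢0 : ∀ {d} → d ≡ 0ℤ → ¬ ((d ≡ + 1) ⊎ (d ≡ - (+ 1)))
    det≢0 refl (inj₁ ())
    det≢0 refl (inj₂ ())

  -- Rows (a,b), (c,d) of a unimodular matrix whose spreads are at most l′:
  -- either a row has no zero entry (then off-axis-bound applies), or the
  -- rows are an x-axis and a y-axis direction (then the axis bounds give
  -- both Δx ≤ l′ and Δy ≤ l′); all other zero patterns make det = 0.
  unimodular-rows-bound : l ≤ Δ P (+ 1) (+ 1) → l ≤ Δ P (+ 1) (- (+ 1)) →
    ∀ a b c d l′ → (a * d - b * c ≡ + 1) ⊎ (a * d - b * c ≡ - (+ 1)) →
    Δ P a b ≤ l′ → Δ P c d ≤ l′ → l ≤ l′
  unimodular-rows-bound l≤Δ₊ l≤Δ₋ a b c d l′ det row₁ row₂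
    with a ≟ 0ℤ | b ≟ 0ℤ | c ≟ 0ℤ | d ≟ 0ℤ
  ... | no a≢0 | no b≢0 | _ | _ = ≤-trans (off-axis-bound l≤Δ₊ l≤Δ₋ a b a≢0 b≢0) row₁
  ... | _ | _ | no c≢0 | no d≢0 = ≤-trans (off-axis-bound l≤Δ₊ l≤Δ₋ c d c≢0 d≢0) row₂
  ... | yes refl | no b≢0 | no c≢0 | yes refl =
    ⊔-lub (≤-trans (x-axis-bound c c≢0) row₂) (≤-trans (y-axis-bound b b≢0) row₁)
  ... | no a≢0 | yes refl | yes refl | no d≢0 =
    ⊔-lub (≤-trans (x-axis-bound a a≢0) row₁) (≤-trans (y-axis-bound d d≢0) row₂)
  ... | yes refl | yes refl | _ | _ = ⊥-elim (det≢0 (cong₂ _-_ (*-zeroˡ d) (*-zeroˡ c)) det)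
  ... | _ | _ | yes refl | yes refl = ⊥-elim (det≢0 (cong₂ _-_ (*-zeroʳ a) (*-zeroʳ b)) det)
  ... | yes refl | no _ | yes refl | no _ = ⊥-elim (det≢0 (cong₂ _-_ (*-zeroˡ d) (*-zeroʳ b)) det)
  ... | no _ | yes refl | no _ | yes refl = ⊥-elim (det≢0 (cong₂ _-_ (*-zeroʳ a) (*-zeroˡ c)) det)

  -- Second claim, lower bound: no unimodular image of P fits in a box of
  -- side smaller than l; each row of T bounds the spread of its direction.
  lattice-size-lower : l ≤ Δ P (+ 1) (+ 1) → l ≤ Δ P (+ 1) (- (+ 1)) →
                       ∀ (l′ : ℤ) (T : AffUnimodular) → MapsIntoBox T P l′ → l ≤ l′
  lattice-size-lower l≤Δ₊ l≤Δ₋ l′ (affUni m11 m12 m21 m22 v1 v2 det) T[P]⊆box =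
    unimodular-rows-bound l≤Δ₊ l≤Δ₋ m11 m12 m21 m22 l′ det
      (Δ-within P m11 m12 v1 l′ λ {(_ , _)} p∈ → proj₁ (lookup T[P]⊆box p∈))
      (Δ-within P m21 m22 v2 l′ λ {(_ , _)} p∈ → proj₂ (lookup T[P]⊆box p∈))

  -- Second claim, upper bound: translating the lower-left corner of the
  -- bounding box to the origin puts P into [0,l]².
  to-corner : AffUnimodular
  to-corner = affUni (+ 1) (+ 0) (+ 0) (+ 1) (- minP P (+ 1) (+ 0)) (- minP P (+ 0) (+ 1)) (inj₁ refl)

  to-corner-fits : MapsIntoBox to-corner P l
  to-corner-fits = tabulate λ { {(_ , _)} p∈ →
    let (x≥0 , x≤Δx) = shifted-range P (+ 1) (+ 0) p∈
        (y≥0 , y≤Δy) = shifted-range P (+ 0) (+ 1) p∈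
    in (x≥0 , ≤-trans x≤Δx (i≤i⊔j Δx Δy)) , (y≥0 , ≤-trans y≤Δy (i≤j⊔i Δx Δy)) }

  -- Third claim: the width is attained by one of the coordinate directions;
  -- axis directions are bounded by the axis estimates, the others by l.
  lattice-width : l ≤ Δ P (+ 1) (+ 1) → l ≤ Δ P (+ 1) (- (+ 1)) → IsLatticeWidth P (Δx ⊓ Δy)
  lattice-width l≤Δ₊ l≤Δ₋ = attained (⊓-sel Δx Δy) , lower
    where
    attained : (Δx ⊓ Δy ≡ Δx) ⊎ (Δx ⊓ Δy ≡ Δy) →
               Σ ℤ λ a → Σ ℤ λ b → Primitive a b × Δ P a b ≡ Δx ⊓ Δy
    attained (inj₁ min≡Δx) = + 1 , + 0 , refl , sym min≡Δx
    attained (inj₂ min≡Δy) = + 0 , + 1 , refl , sym min≡Δy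
    lower : ∀ a b → Primitive a b → Δx ⊓ Δy ≤ Δ P a b
    lower a b prim with a ≟ 0ℤ | b ≟ 0ℤ
    ... | yes refl | yes refl with () ← +-injective prim
    ... | yes refl | no b≢0 = ≤-trans (i⊓j≤j Δx Δy) (y-axis-bound b b≢0)
    ... | no a≢0 | yes refl = ≤-trans (i⊓j≤i Δx Δy) (x-axis-bound a a≢0)
    ... | no a≢0 | no b≢0 =
      ≤-trans (i⊓j≤i Δx Δy)
              (≤-trans (i≤i⊔j Δx Δy) (off-axis-bound l≤Δ₊ l≤Δ₋ a b a≢0 b≢0))

mainTheorem1 : (P : LatticePolygon) →
    e□ P ≤ Δ P (+ 1) (+ 1) →
    e□ P ≤ Δ P (+ 1) (- (+ 1)) →
    ((a b : ℤ) → Primitive a b → ¬ AxisDir a b → e□ P ≤ Δ P a b)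
    × IsLatticeSize P (e□ P)
    × IsLatticeWidth P (Δ P (+ 1) (+ 0) ⊓ Δ P (+ 0) (+ 1))
mainTheorem1 P l≤Δ₊ l≤Δ₋ =
    primitive-bound P l≤Δ₊ l≤Δ₋
  , ((to-corner P , to-corner-fits P) , lattice-size-lower P l≤Δ₊ l≤Δ₋)
  , lattice-width P l≤Δ₊ l≤Δ₋
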